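{- For all $n\ge 0$ let $S_n(2413,3142,P_3)$ be the set of permutations of $[n]$ (including the empty permutation for $n=0$) that avoid the classical patterns $2413$ and $3142$ and the partially ordered pattern $P_3$. Then $$F_3(x,p,q,u,v,s,t)=\sum_{n\geq 0}x^n\sum_{\sigma \in S_n(2413,3142,P_3)}p^{\mathrm{asc}(\sigma)}q^{\mathrm{des}(\sigma)}u^{\mathrm{lrmax}(\sigma)}v^{\mathrm{rlmax}(\sigma)}s^{\mathrm{lrmin}(\sigma)}t^{\mathrm{rlmin}(\sigma)}$$ is given by $$F_3=\frac{1+q^2v^2sx^2+vtusx(1+ptux)-qvx\left(1+pus^2x^2vt(-1+t)(-1+u)+s(1+px+vtux)\right)}{1+q^2v^2sx^2-qvx(1+s+psx)}.$$
   Context: A permutation $\pi=\pi_1\cdots\pi_n$ avoids a classical pattern $p=p_1\cdots p_k$ if there is no subsequence $\pi_{i_1}\cdots\pi_{i_k}$ ($i_1<\cdots<i_k$) order-isomorphic to $p$. For $k\ge1$, $P_k$ is the partially ordered pattern of length $k$ whose poset on $\{1,\dots,k\}$ has $k$ greater than each of $1,\dots,k-1$ and $1,\dots,k-1$ pairwise incomparable; a permutation $\pi$ avoids $P_k$ iff there are no indices $i_1<\cdots<i_k$ with $\pi_{i_j}<\pi_{i_k}$ for all $j<k$ (so avoiding $P_3$ is the same as avoiding both $123$ and $213$). Statistics: $\mathrm{asc}(\pi)$ (resp. $\mathrm{des}(\pi)$) is the number of $i\in[n-1]$ with $\pi_i<\pi_{i+1}$ (resp. $\pi_i>\pi_{i+1}$);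 $\mathrm{lrmax}$, $\mathrm{rlmax}$, $\mathrm{lrmin}$, $\mathrm{rlmin}$ count left-to-right maxima, right-to-left maxima, left-to-right minima and right-to-left minima respectively ($\pi_i$ is a right-to-left maximum if it exceeds every entry to its right, etc.; $\pi_n$ is always a right-to-left maximum and minimum). The empty permutation contributes $1$. -}

module Defs where

open import Data.Nat as ℕ using (ℕ; zero; suc; _<ᵇ_; _≡ᵇ_)
open import Data.Bool using (Bool; true; false; _∧_; _∨_; not; if_then_else_)
open import Data.List using (List; []; _∷_; map; concatMap; filter; length; reverse; upTo; foldr; zipWith)
open import Data.Bool.ListAction using (and; or)
open import Data.Integer as ℤ using (ℤ; +_; -_; _+_; _*_; _-_; _^_)
open import Data.Product using (_×_; _,_)

-- Words / permutations are lists of natural numbers (values 0..n-1).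

words : ℕ → ℕ → List (List ℕ)
words n zero    = [] ∷ []
words n (suc m) = concatMap (λ w → map (_∷ w) (upTo n)) (words n m)

notIn : ℕ → List ℕ → Bool
notIn x ys = and (map (λ y → not (x ≡ᵇ y)) ys)

distinct : List ℕ → Bool
distinct []       = true
distinct (x ∷ xs) = notIn x xs ∧ distinct xs

perms : ℕ → List (List ℕ)
perms n = filter (λ w → Data.Bool._≟_ (distinct w) true) (words n n)
  where import Data.Bool

subseqs : ℕ → List ℕ → List (List ℕ)
subseqs zero    _        = [] ∷ []
subseqs (suc k) []       = []
subseqs (suc k) (x ∷ xs) = map (x ∷_) (subseqs k xs) ++ subseqs (suc k) xs
  where open import Data.List using (_++_)

iff : Bool → Bool → Bool
iff a b = (a ∧ b) ∨ (not a ∧ not b)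

orderIso : List ℕ → List ℕ → Bool
orderIso []       []       = true
orderIso (a ∷ as) (b ∷ bs) =
  and (zipWith (λ c d → iff (a <ᵇ c) (b <ᵇ d)) as bs) ∧ orderIso as bs
orderIso _        _        = false

containsClassical : List ℕ → List ℕ → Bool
containsClassical p π = or (map (λ s → orderIso s p) (subseqs (length p) π))

isP3 : List ℕ → Bool
isP3 (a ∷ b ∷ c ∷ []) = (a <ᵇ c) ∧ (b <ᵇ c)
isP3 _                = false

containsP3 : List ℕ → Bool
containsP3 π = or (map isP3 (subseqs 3 π))

pat2413 pat3142 : List ℕ
pat2413 = 2 ∷ 4 ∷ 1 ∷ 3 ∷ []
pat3142 = 3 ∷ 1 ∷ 4 ∷ 2 ∷ []

avoidsAll : List ℕ → Bool
avoidsAll π = not (containsClassical pat2413 π) ∧ not (containsClassical pat3142 π)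
              ∧ not (containsP3 π)

Sn : ℕ → List (List ℕ)
Sn n = filter (λ w → Data.Bool._≟_ (avoidsAll w) true) (perms n)
  where import Data.Bool

asc : List ℕ → ℕ
asc (a ∷ b ∷ xs) = (if a <ᵇ b then 1 else 0) ℕ.+ asc (b ∷ xs)
asc _            = 0

des : List ℕ → ℕ
des (a ∷ b ∷ xs) = (if b <ᵇ a then 1 else 0) ℕ.+ des (b ∷ xs)
des _            = 0

lrmaxFrom : ℕ → List ℕ → ℕ
lrmaxFrom m []       = 0
lrmaxFrom m (y ∷ ys) = if m <ᵇ y then suc (lrmaxFrom y ys) else lrmaxFrom m ys

lrminFrom : ℕ → List ℕ → ℕ
lrminFrom m []       = 0
lrminFrom m (y ∷ ys) = if y <ᵇ m then suc (lrminFrom y ys) else lrminFrom m ys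

lrmax lrmin rlmax rlmin : List ℕ → ℕ
lrmax []       = 0
lrmax (x ∷ xs) = suc (lrmaxFrom x xs)
lrmin []       = 0
lrmin (x ∷ xs) = suc (lrminFrom x xs)
rlmax π = lrmax (reverse π)
rlmin π = lrmin (reverse π)

sumℤ : List ℤ → ℤ
sumℤ = foldr _+_ (+ 0)

F3coeff : (p q u v s t : ℤ) → ℕ → ℤ
F3coeff p q u v s t n =
  sumℤ (map (λ σ → p ^ asc σ * q ^ des σ * u ^ lrmax σ * v ^ rlmax σ
                   * s ^ lrmin σ * t ^ rlmin σ) (Sn n))

-- coefficients (in x) of the denominator
--   1 + q²v²s x² - q v x (1 + s + p s x)
den : (p q u v s t : ℤ) → ℕ → ℤ
den p q u v s t 0 = + 1
den p q u v s t 1 = - (q * v * (+ 1 + s))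
den p q u v s t 2 = q * q * v * v * s - q * v * p * s
den p q u v s t _ = + 0

-- coefficients (in x) of the numerator
--   1 + q²v²s x² + v t u s x (1 + p t u x)
--     - q v x (1 + p u s² x² v t (t-1)(u-1) + s (1 + p x + v t u x))
num : (p q u v s t : ℤ) → ℕ → ℤ
num p q u v s t 0 = + 1
num p q u v s t 1 = v * t * u * s - q * v * (+ 1 + s)
num p q u v s t 2 = q * q * v * v * s + v * t * u * s * (p * t * u)
                    - q * v * (s * (p + v * t * u))
num p q u v s t 3 = - (q * v * (p * u * s * s * v * t * (- (+ 1) + t) * (- (+ 1) + u)))
num p q u v s t _ = + 0

conv : (ℕ → ℤ) → (ℕ → ℤ) → ℕ → ℤ
conv f g n = sumℤ (map (λ i → f i * g (n ℕ.∸ i)) (upTo (suc n)))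

module Submission where

-- The patterns 2413 and 3142 contain the occurrences 2·1·3 and 3·1·4 of P₃, so S_n(2413,3142,P₃) is
-- just S_n(P₃). In a P₃-avoiding permutation of [n], n ≥ 2, the entry n is first or second (two earlier
-- entries would form a P₃ with it), deleting it leaves a P₃-avoiding permutation of [n-1], and both ways
-- of inserting a new maximum preserve P₃-avoidance. Let a_k and b_k be the sums of the weights without u
-- over the permutations in S_{k+2}(P₃) with maximum first, resp. second. Tracking how the insertion
-- changes the statistics gives a_{k+1} = qvs (a_k + b_k) and b_{k+1} = p a_k + qv b_k, and the
-- coefficient of x^{k+2} is u a_k + u² b_k, as the left-to-right maxima are the maximum and, when it is
-- second, the first entry. The denominator is the characteristic polynomial 1 - tr x + det x² of the
-- matrix (qvs qvs ; p qv), so it annihilates the coefficients of x⁴ and beyond; the numerator is what it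
-- leaves of the first four.

open import Defs
open import Data.Bool as Bool using (Bool; true; false; not; T)
open import Data.Bool.Properties using (T-∧; T-≡)
open import Data.Bool.ListAction using (and; or)
open import Algebra.Bundles using (CommutativeMonoid)
open import Data.Empty using (⊥-elim)
open import Data.Integer as ℤ using (ℤ; +_; _+_; _*_; _^_; -_; _-_)
import Data.Integer.Properties as ℤ
open import Data.Integer.Tactic.RingSolver using (solve-∀)
open import Data.List
  using (List; []; _∷_; _++_; [_]; length; map; reverse; upTo; applyUpTo; zipWith;
         concatMap; cartesianProductWith)
import Data.List.Properties as List
open import Data.List.Membership.Propositional using (_∈_; _∉_; find; lose)
open import Data.List.Membership.Propositional.Properties
  using (∈-++⁻; ∈-++⁺ˡ; ∈-++⁺ʳ; ∈-map⁻; ∈-map⁺; ∈-filter⁻; ∈-filter⁺; ∈-∃++; ∈-upTo⁻; ∈-upTo⁺;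
         ∈-cartesianProductWith⁻; ∈-cartesianProductWith⁺)
open import Data.List.Relation.Unary.All as All using (All; []; _∷_)
open import Data.List.Relation.Unary.Any using (here; there)
import Data.List.Relation.Unary.Any.Properties as Any
import Data.List.Relation.Unary.AllPairs as AllPairs
open import Data.List.Relation.Unary.AllPairs using ([]; _∷_)
open import Data.List.Relation.Unary.Unique.Propositional using (Unique)
import Data.List.Relation.Unary.Unique.Propositional.Properties as Unique
open import Data.List.Relation.Binary.Sublist.Propositional
  using (_⊆_; []; _∷_; _∷ʳ_; ⊆-refl; ⊆-trans; minimum; from∈)
open import Data.List.Relation.Binary.Sublist.Propositional.Properties using (All-resp-⊆; ++⁺)
open import Data.List.Relation.Binary.Permutation.Propositional using (_↭_; ↭⇒↭ₛ; ↭-sym)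
open import Data.List.Relation.Binary.Permutation.Propositional.Properties as Perm
  using (shift; ↭-length; ↭-reverse; All-resp-↭)
open import Data.List.Relation.Binary.Permutation.Setoid.Properties using (foldr-commMonoid)
open import Data.List.Relation.Binary.BagAndSetEquality using (∼bag⇒↭)
open import Data.List.Membership.Propositional.Properties.WithK using (unique∧set⇒bag)
open import Data.List.Relation.Binary.Disjoint.Propositional using (Disjoint)
open import Data.Nat as ℕ using (ℕ; zero; suc; _<_; _≤_; _<ᵇ_; z≤n; s≤s; s≤s⁻¹)
open import Data.Nat.Properties as ℕ
  using (_≟_; _<?_; <ᵇ⇒<; <⇒<ᵇ; <ᵇ-reflects-<; <⇒≢; >⇒≢; ≤∧≢⇒<; <⇒≤; <⇒≱; ≤⇒≯; ≮⇒≥; ≤-trans;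
         1+n≰n; m≤n⇒m≤1+n; m<n⇒m<1+n; n<1+n)
open import Data.List.Membership.DecPropositional _≟_ using (_∈?_)
open import Data.Product as Product using (∃; _×_; _,_; proj₁; proj₂)
open import Data.Sum using (inj₁; inj₂)
open import Function using (_∘_; flip; const; _⇔_; mk⇔; Equivalence)
open Equivalence using (to; from)
open import Relation.Nullary using (¬_; yes; no)
open import Relation.Nullary.Reflects using (Reflects; ofʸ; ofⁿ; T-reflects; ¬-reflects; _×-reflects_)
open import Relation.Nullary.Decidable using (proof; dec-true; dec-false)
open import Relation.Binary.PropositionalEquality hiding ([_])
open import Data.List.Relation.Binary.Permutation.Setoid.Properties (setoid ℕ) using (Unique-resp-↭)

private
  variable
    m x y z N n : ℕ
    σ τ ρ xs ys ws : List ℕ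

reflects⇒T⇔ : ∀ {A : Set} {b} → Reflects A b → T b ⇔ A
reflects⇒T⇔ (ofʸ a)  = mk⇔ (const a) (const _)
reflects⇒T⇔ (ofⁿ ¬a) = mk⇔ (λ ()) ¬a

map-reflects : ∀ {A B : Set} {b} → (A → B) → (B → A) → Reflects A b → Reflects B b
map-reflects f g (ofʸ a)  = ofʸ (f a)
map-reflects f g (ofⁿ ¬a) = ofⁿ (¬a ∘ g)

T-not⇔ : ∀ {b} → T (not b) ⇔ (¬ T b)
T-not⇔ {b} = reflects⇒T⇔ (¬-reflects (T-reflects b))

T-and⁻ : ∀ {bs} → T (and bs) → All T bs
T-and⁻ {[]}     _ = []
T-and⁻ {_ ∷ bs} h = proj₁ (to T-∧ h) ∷ T-and⁻ (proj₂ (to T-∧ h))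

-- Occurrences of P₃

data HasP3 (σ : List ℕ) : Set where
  p3 : ∀ {a b c} → a ∷ b ∷ c ∷ [] ⊆ σ → a < c → b < c → HasP3 σ

HasP3-resp-⊆ : τ ⊆ σ → HasP3 τ → HasP3 σ
HasP3-resp-⊆ τ⊆σ (p3 occ a<c b<c) = p3 (⊆-trans occ τ⊆σ) a<c b<c

∈-subseqs⁻ : ∀ k xs {s} → s ∈ subseqs k xs → s ⊆ xs × length s ≡ k
∈-subseqs⁻ zero    xs       (here refl) = minimum xs , refl
∈-subseqs⁻ (suc k) (x ∷ xs) s∈ with ∈-++⁻ (map (x ∷_) (subseqs k xs)) s∈
... | inj₂ s∈′ = Product.map₁ (x ∷ʳ_) (∈-subseqs⁻ (suc k) xs s∈′)
... | inj₁ s∈′ with ∈-map⁻ (x ∷_) s∈′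
...   | s′ , s′∈ , refl = Product.map (refl ∷_) (cong suc) (∈-subseqs⁻ k xs s′∈)

∈-subseqs⁺ : ∀ {s} → s ⊆ xs → s ∈ subseqs (length s) xs
∈-subseqs⁺           []          = here refl
∈-subseqs⁺ {s = []}    (x ∷ʳ _)   = here refl
∈-subseqs⁺ {s = _ ∷ s} (x ∷ʳ s⊆) = ∈-++⁺ʳ (map (x ∷_) (subseqs (length s) _)) (∈-subseqs⁺ s⊆)
∈-subseqs⁺             (refl ∷ s⊆) = ∈-++⁺ˡ (∈-map⁺ _ (∈-subseqs⁺ s⊆))

T-any-subseqs⁻ : ∀ (f : List ℕ → Bool) k σ →
  T (or (map f (subseqs k σ))) → ∃ λ s → s ⊆ σ × length s ≡ k × T (f s)
T-any-subseqs⁻ f k σ h with find (Any.any⁻ f (subseqs k σ) h)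
... | s , s∈ , fs = let (s⊆σ , len) = ∈-subseqs⁻ k σ s∈ in s , s⊆σ , len , fs

containsP3⇔HasP3 : ∀ σ → T (containsP3 σ) ⇔ HasP3 σ
containsP3⇔HasP3 σ = mk⇔ found occurring
  where
  found : T (containsP3 σ) → HasP3 σ
  found h with T-any-subseqs⁻ isP3 3 σ h
  ... | a ∷ b ∷ c ∷ [] , occ , refl , a<c∧b<c =
    let (a<c , b<c) = to T-∧ a<c∧b<c in p3 occ (<ᵇ⇒< a c a<c) (<ᵇ⇒< b c b<c)
  occurring : HasP3 σ → T (containsP3 σ)
  occurring (p3 occ a<c b<c) =
    Any.any⁺ isP3 (lose (∈-subseqs⁺ occ) (from T-∧ (<⇒<ᵇ a<c , <⇒<ᵇ b<c)))

containsClassical⇒HasP3 : ∀ π → (∀ {s} → length s ≡ length π → T (orderIso s π) → HasP3 s) →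
                          ∀ σ → T (containsClassical π σ) → HasP3 σ
containsClassical⇒HasP3 π occurrence⇒P3 σ h
  with T-any-subseqs⁻ (λ s → orderIso s π) (length π) σ h
... | s , s⊆σ , len , iso = HasP3-resp-⊆ s⊆σ (occurrence⇒P3 len iso)

orderIso-∷⁻ : ∀ a as b bs → T (orderIso (a ∷ as) (b ∷ bs)) →
              All T (zipWith (λ c d → iff (a <ᵇ c) (b <ᵇ d)) as bs) × T (orderIso as bs)
orderIso-∷⁻ _ _ _ _ iso = Product.map₁ T-and⁻ (to T-∧ iso)

T-iff⇒< : ∀ {a b} → T (iff (a <ᵇ b) true) → a < b
T-iff⇒< {a} {b} h with a <ᵇ b | <ᵇ⇒< a b
... | true | a<b = a<b _

2413⇒HasP3 : ∀ {s} → length s ≡ 4 → T (orderIso s pat2413) → HasP3 s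
2413⇒HasP3 {a ∷ b ∷ c ∷ d ∷ []} refl iso
  with orderIso-∷⁻ a (b ∷ c ∷ d ∷ []) 2 (4 ∷ 1 ∷ 3 ∷ []) iso
... | _ ∷ _ ∷ a<d ∷ [] , iso₁ with orderIso-∷⁻ b (c ∷ d ∷ []) 4 (1 ∷ 3 ∷ []) iso₁
... | _ , iso₂ with orderIso-∷⁻ c (d ∷ []) 1 (3 ∷ []) iso₂
... | c<d ∷ [] , _ = p3 (refl ∷ b ∷ʳ refl ∷ refl ∷ []) (T-iff⇒< a<d) (T-iff⇒< c<d)

3142⇒HasP3 : ∀ {s} → length s ≡ 4 → T (orderIso s pat3142) → HasP3 s
3142⇒HasP3 {a ∷ b ∷ c ∷ d ∷ []} refl iso
  with orderIso-∷⁻ a (b ∷ c ∷ d ∷ []) 3 (1 ∷ 4 ∷ 2 ∷ []) iso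
... | _ ∷ a<c ∷ _ ∷ [] , iso₁ with orderIso-∷⁻ b (c ∷ d ∷ []) 1 (4 ∷ 2 ∷ []) iso₁
... | b<c ∷ _ ∷ [] , _ = p3 (refl ∷ refl ∷ refl ∷ d ∷ʳ []) (T-iff⇒< a<c) (T-iff⇒< b<c)

avoidsAll⇔P3-free : ∀ σ → T (avoidsAll σ) ⇔ (¬ HasP3 σ)
avoidsAll⇔P3-free σ = mk⇔ P3-free avoids-all
  where
  c₁ c₂ : Bool
  c₁ = containsClassical pat2413 σ
  c₂ = containsClassical pat3142 σ
  P3-free : T (avoidsAll σ) → ¬ HasP3 σ
  P3-free h = to T-not⇔ (proj₂ (to (T-∧ {not c₂}) (proj₂ (to (T-∧ {not c₁}) h))))
            ∘ from (containsP3⇔HasP3 σ)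
  avoids : ∀ {c} → (T c → HasP3 σ) → ¬ HasP3 σ → T (not c)
  avoids contains⇒HasP3 free = from T-not⇔ (free ∘ contains⇒HasP3)
  avoids-all : ¬ HasP3 σ → T (avoidsAll σ)
  avoids-all free = from T-∧ (avoids (containsClassical⇒HasP3 pat2413 2413⇒HasP3 σ) free ,
                    from T-∧ (avoids (containsClassical⇒HasP3 pat3142 3142⇒HasP3 σ) free ,
                              avoids (to (containsP3⇔HasP3 σ)) free))

record P3FreePerm (n : ℕ) (σ : List ℕ) : Set where
  field
    length≡ : length σ ≡ n
    bounded : All (_< n) σ
    unique  : Unique σ
    P3-free : ¬ HasP3 σ

notIn-reflects : ∀ x ys → Reflects (All (x ≢_) ys) (notIn x ys)
notIn-reflects x []       = ofʸ []
notIn-reflects x (y ∷ ys) = map-reflects (Product.uncurry _∷_) All.uncons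
  (¬-reflects (proof (x ≟ y)) ×-reflects notIn-reflects x ys)

distinct-reflects : ∀ xs → Reflects (Unique xs) (distinct xs)
distinct-reflects []       = ofʸ []
distinct-reflects (x ∷ xs) = map-reflects (Product.uncurry _∷_) AllPairs.uncons
  (notIn-reflects x xs ×-reflects distinct-reflects xs)

concatMap-map≡cartesianProductWith : ∀ {A B C : Set} (f : A → B → C) xs ys →
  concatMap (λ x → map (f x) ys) xs ≡ cartesianProductWith f xs ys
concatMap-map≡cartesianProductWith f []       ys = refl
concatMap-map≡cartesianProductWith f (x ∷ xs) ys =
  cong (map (f x) ys ++_) (concatMap-map≡cartesianProductWith f xs ys)

words-suc : ∀ n m → words n (suc m) ≡ cartesianProductWith (flip _∷_) (words n m) (upTo n)
words-suc n m = concatMap-map≡cartesianProductWith (flip _∷_) (words n m) (upTo n)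

∈-words⁻ : ∀ n m {w} → w ∈ words n m → length w ≡ m × All (_< n) w
∈-words⁻ n zero    (here refl) = refl , []
∈-words⁻ n (suc m) w∈
  with ∈-cartesianProductWith⁻ (flip _∷_) (words n m) (upTo n) (subst (_ ∈_) (words-suc n m) w∈)
... | w , i , w∈′ , i∈ , refl = Product.map (cong suc) (∈-upTo⁻ i∈ ∷_) (∈-words⁻ n m w∈′)

∈-words⁺ : ∀ n {w} → All (_< n) w → w ∈ words n (length w)
∈-words⁺ n []                = here refl
∈-words⁺ n {i ∷ w} (i<n ∷ w<n) = subst (_ ∈_) (sym (words-suc n (length w)))
  (∈-cartesianProductWith⁺ (flip _∷_) (∈-words⁺ n w<n) (∈-upTo⁺ i<n))

words-unique : ∀ n m → Unique (words n m)
words-unique n zero    = [] ∷ []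
words-unique n (suc m) = subst Unique (sym (words-suc n m))
  (Unique.cartesianProductWith⁺ (flip _∷_) (Product.swap ∘ List.∷-injective)
                                (words-unique n m) (Unique.upTo⁺ n))

Sn-unique : ∀ n → Unique (Sn n)
Sn-unique n = Unique.filter⁺ _ (Unique.filter⁺ _ (words-unique n n))

∈-Sn⇔ : ∀ n σ → σ ∈ Sn n ⇔ P3FreePerm n σ
∈-Sn⇔ n σ = mk⇔ sound complete
  where
  sound : σ ∈ Sn n → P3FreePerm n σ
  sound σ∈ =
    let (σ∈perms , avoids) = ∈-filter⁻ (λ w → avoidsAll w Bool.≟ true) σ∈
        (σ∈words , dist)   = ∈-filter⁻ (λ w → distinct w Bool.≟ true) σ∈perms
        (len , bnd)        = ∈-words⁻ n n σ∈words
    in record { length≡ = len ; bounded = bnd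
              ; unique  = to (reflects⇒T⇔ (distinct-reflects σ)) (from T-≡ dist)
              ; P3-free = to (avoidsAll⇔P3-free σ) (from T-≡ avoids) }
  complete : P3FreePerm n σ → σ ∈ Sn n
  complete perm = ∈-filter⁺ _
    (∈-filter⁺ _ (subst (λ m → σ ∈ words n m) length≡ (∈-words⁺ n bounded))
                 (to T-≡ (from (reflects⇒T⇔ (distinct-reflects σ)) unique)))
    (to T-≡ (from (avoidsAll⇔P3-free σ) P3-free))
    where open P3FreePerm perm

Sn-bounded : ∀ n → τ ∈ Sn n → All (_< n) τ
Sn-bounded n τ∈ = P3FreePerm.bounded (to (∈-Sn⇔ n _) τ∈)

-- Decomposition by the position of the maximum

⊆-delete : ∀ xs {y : ℕ} {ys} → xs ++ ys ⊆ xs ++ y ∷ ys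
⊆-delete xs {y} = ++⁺ ⊆-refl (y ∷ʳ ⊆-refl)

Unique-delete : ∀ xs {y : ℕ} {ys} → Unique (xs ++ y ∷ ys) → y ∉ xs ++ ys × Unique (xs ++ ys)
Unique-delete xs {y} {ys} u with Unique-resp-↭ (↭⇒↭ₛ (shift y xs ys)) u
... | y∉ ∷ u′ = Unique.Unique[x∷xs]⇒x∉xs (y∉ ∷ u′) , u′

All<-pred : n ∉ xs → All (_< suc n) xs → All (_< n) xs
All<-pred n∉xs xs≤n = All.tabulate λ x∈xs →
  ≤∧≢⇒< (s≤s⁻¹ (All.lookup xs≤n x∈xs)) λ { refl → n∉xs x∈xs }

Unique-length≤ : ∀ n → Unique xs → All (_< n) xs → length xs ≤ n
Unique-length≤ {[]}    zero    _ _        = z≤n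
Unique-length≤ {_ ∷ _} zero    _ (() ∷ _)
Unique-length≤ {xs}    (suc n) u xs<1+n with n ∈? xs
... | no n∉xs = m≤n⇒m≤1+n (Unique-length≤ n u (All<-pred n∉xs xs<1+n))
... | yes n∈xs with ∈-∃++ n∈xs
...   | ys , zs , refl with Unique-delete ys u
...     | n∉ , u′ = begin
  length (ys ++ n ∷ zs)   ≡⟨ ↭-length (shift n ys zs) ⟩
  suc (length (ys ++ zs)) ≤⟨ s≤s (Unique-length≤ n u′ ys++zs<n) ⟩
  suc n                   ∎
  where
  open ℕ.≤-Reasoning
  ys++zs<n : All (_< n) (ys ++ zs)
  ys++zs<n = All<-pred n∉ (All-resp-⊆ (⊆-delete ys) xs<1+n)

max-∈ : P3FreePerm (suc n) σ → n ∈ σ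
max-∈ {n} {σ} perm with n ∈? σ
... | yes n∈σ = n∈σ
... | no  n∉σ =
  ⊥-elim (1+n≰n (subst (_≤ n) length≡ (Unique-length≤ n unique (All<-pred n∉σ bounded))))
  where open P3FreePerm perm

P3FreePerm-delete-max : ∀ xs {ys : List ℕ} → P3FreePerm (suc n) (xs ++ n ∷ ys) → P3FreePerm n (xs ++ ys)
P3FreePerm-delete-max {n} xs {ys} perm with Unique-delete xs (P3FreePerm.unique perm)
... | n∉ , unique′ = record
  { length≡ = ℕ.suc-injective (trans (sym (↭-length (shift n xs ys))) length≡)
  ; bounded = All<-pred n∉ (All-resp-⊆ (⊆-delete xs) bounded)
  ; unique  = unique′
  ; P3-free = P3-free ∘ HasP3-resp-⊆ (⊆-delete xs)
  }
  where open P3FreePerm perm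

HasP3-delete-max-first : All (_≤ N) τ → HasP3 (N ∷ τ) → HasP3 τ
HasP3-delete-max-first τ≤N (p3 (_ ∷ʳ occ) a<c b<c) = p3 occ a<c b<c
HasP3-delete-max-first τ≤N (p3 (refl ∷ occ) N<c _) with All-resp-⊆ occ τ≤N
... | _ ∷ c≤N ∷ [] = ⊥-elim (<⇒≱ N<c c≤N)

HasP3-delete-max-second : All (_≤ N) ρ → HasP3 (x ∷ N ∷ ρ) → HasP3 (x ∷ ρ)
HasP3-delete-max-second {x = x} ρ≤N (p3 (_ ∷ʳ occ) a<c b<c) =
  HasP3-resp-⊆ (x ∷ʳ ⊆-refl) (HasP3-delete-max-first ρ≤N (p3 occ a<c b<c))
HasP3-delete-max-second ρ≤N (p3 (refl ∷ _ ∷ʳ occ) a<c b<c) = p3 (refl ∷ occ) a<c b<c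
HasP3-delete-max-second ρ≤N (p3 (refl ∷ refl ∷ occ) _ N<c) with All-resp-⊆ occ ρ≤N
... | c≤N ∷ [] = ⊥-elim (<⇒≱ N<c c≤N)

Unique-∷-max : All (_< N) xs → Unique xs → Unique (N ∷ xs)
Unique-∷-max xs<N u = All.map >⇒≢ xs<N ∷ u

All<-∷-max : All (_< N) xs → All (_< suc N) (N ∷ xs)
All<-∷-max {N} xs<N = n<1+n N ∷ All.map m<n⇒m<1+n xs<N

P3FreePerm-max-first : P3FreePerm N τ → P3FreePerm (suc N) (N ∷ τ)
P3FreePerm-max-first perm = record
  { length≡ = cong suc length≡
  ; bounded = All<-∷-max bounded
  ; unique  = Unique-∷-max bounded unique
  ; P3-free = P3-free ∘ HasP3-delete-max-first (All.map <⇒≤ bounded)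
  }
  where open P3FreePerm perm

P3FreePerm-max-second : P3FreePerm N (x ∷ ρ) → P3FreePerm (suc N) (x ∷ N ∷ ρ)
P3FreePerm-max-second perm with P3FreePerm.bounded perm | P3FreePerm.unique perm
... | x<N ∷ ρ<N | x≢ρ ∷ uρ = record
  { length≡ = cong suc length≡
  ; bounded = m<n⇒m<1+n x<N ∷ All<-∷-max ρ<N
  ; unique  = (<⇒≢ x<N ∷ x≢ρ) ∷ Unique-∷-max ρ<N uρ
  ; P3-free = P3-free ∘ HasP3-delete-max-second (All.map <⇒≤ ρ<N)
  }
  where open P3FreePerm perm

data MaxPosition (N : ℕ) : List ℕ → Set where
  first  : P3FreePerm N τ → MaxPosition N (N ∷ τ)
  second : P3FreePerm N (x ∷ ρ) → MaxPosition N (x ∷ N ∷ ρ)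

max-position : P3FreePerm (suc N) σ → MaxPosition N σ
max-position perm with ∈-∃++ (max-∈ perm)
... | []          , _ , refl = first  (P3FreePerm-delete-max [] perm)
... | x ∷ []      , _ , refl = second (P3FreePerm-delete-max (x ∷ []) perm)
... | x ∷ y ∷ xs , _ , refl with P3FreePerm.bounded (P3FreePerm-delete-max (x ∷ y ∷ xs) perm)
...   | x<N ∷ y<N ∷ _ =
  ⊥-elim (P3FreePerm.P3-free perm (p3 (refl ∷ refl ∷ from∈ (∈-++⁺ʳ xs (here refl))) x<N y<N))

insertSecond : ℕ → List ℕ → List ℕ
insertSecond N []       = N ∷ []
insertSecond N (x ∷ xs) = x ∷ N ∷ xs

insertSecond-injective : insertSecond N xs ≡ insertSecond N ys → xs ≡ ys
insertSecond-injective {xs = []}    {ys = []}    _    = refl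
insertSecond-injective {xs = _ ∷ _} {ys = _ ∷ _} refl = refl
insertSecond-injective {xs = []}    {ys = _ ∷ _} ()
insertSecond-injective {xs = _ ∷ _} {ys = []}    ()

[]∉Sn-suc : ∀ n → [] ∉ Sn (suc n)
[]∉Sn-suc n []∈ with P3FreePerm.length≡ (to (∈-Sn⇔ (suc n) []) []∈)
... | ()

Sn-suc-suc-↭ : ∀ n →
  Sn (suc (suc n)) ↭ map (suc n ∷_) (Sn (suc n)) ++ map (insertSecond (suc n)) (Sn (suc n))
Sn-suc-suc-↭ n = ∼bag⇒↭ (unique∧set⇒bag (Sn-unique (suc M))
  (Unique.++⁺ (Unique.map⁺ (proj₂ ∘ List.∷-injective) (Sn-unique M))
              (Unique.map⁺ insertSecond-injective (Sn-unique M)) disjoint)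
  (mk⇔ split join))
  where
  M : ℕ
  M = suc n
  split : σ ∈ Sn (suc M) → σ ∈ map (M ∷_) (Sn M) ++ map (insertSecond M) (Sn M)
  split σ∈ with max-position {M} (to (∈-Sn⇔ _ _) σ∈)
  ... | first  perm = ∈-++⁺ˡ (∈-map⁺ (M ∷_) (from (∈-Sn⇔ _ _) perm))
  ... | second perm = ∈-++⁺ʳ _ (∈-map⁺ (insertSecond M) (from (∈-Sn⇔ _ _) perm))
  join : σ ∈ map (M ∷_) (Sn M) ++ map (insertSecond M) (Sn M) → σ ∈ Sn (suc M)
  join σ∈ with ∈-++⁻ (map (M ∷_) (Sn M)) σ∈
  ... | inj₁ σ∈′ with ∈-map⁻ (M ∷_) σ∈′
  ...   | τ , τ∈ , refl = from (∈-Sn⇔ _ _) (P3FreePerm-max-first (to (∈-Sn⇔ _ _) τ∈))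
  join σ∈ | inj₂ σ∈′ with ∈-map⁻ (insertSecond M) σ∈′
  ...   | []    , τ∈ , refl = ⊥-elim ([]∉Sn-suc n τ∈)
  ...   | _ ∷ _ , τ∈ , refl = from (∈-Sn⇔ _ _) (P3FreePerm-max-second (to (∈-Sn⇔ _ _) τ∈))
  disjoint : Disjoint (map (M ∷_) (Sn M)) (map (insertSecond M) (Sn M))
  disjoint (σ∈₁ , σ∈₂) with ∈-map⁻ (M ∷_) σ∈₁ | ∈-map⁻ (insertSecond M) σ∈₂
  ... | _ , _ , refl | []    , τ∈ , _    = []∉Sn-suc n τ∈
  ... | _ , _ , refl | _ ∷ _ , τ∈ , refl =
    ℕ.<-irrefl refl (All.head (Sn-bounded M τ∈))

<ᵇ-true : x < y → (x <ᵇ y) ≡ true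
<ᵇ-true {x} {y} = dec-true (x <? y)

<ᵇ-false : y ≤ x → (x <ᵇ y) ≡ false
<ᵇ-false {y} {x} y≤x = dec-false (x <? y) (≤⇒≯ y≤x)

asc-descent : ∀ σ → y < x → asc (x ∷ y ∷ σ) ≡ asc (y ∷ σ)
asc-descent _ y<x rewrite <ᵇ-false (<⇒≤ y<x) = refl

asc-ascent : ∀ σ → x < y → asc (x ∷ y ∷ σ) ≡ suc (asc (y ∷ σ))
asc-ascent _ x<y rewrite <ᵇ-true x<y = refl

des-descent : ∀ σ → y < x → des (x ∷ y ∷ σ) ≡ suc (des (y ∷ σ))
des-descent _ y<x rewrite <ᵇ-true y<x = refl

des-ascent : ∀ σ → x < y → des (x ∷ y ∷ σ) ≡ des (y ∷ σ)
des-ascent _ x<y rewrite <ᵇ-false (<⇒≤ x<y) = refl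

lrmin-descent : ∀ σ → y < x → lrmin (x ∷ y ∷ σ) ≡ suc (lrmin (y ∷ σ))
lrmin-descent _ y<x rewrite <ᵇ-true y<x = refl

lrmin-ascent : ∀ σ → x ≤ y → lrmin (x ∷ y ∷ σ) ≡ lrmin (x ∷ σ)
lrmin-ascent _ x≤y rewrite <ᵇ-false x≤y = refl

lrmax-max-first : All (_≤ N) σ → lrmax (N ∷ σ) ≡ 1
lrmax-max-first = cong suc ∘ lrmaxFrom-≤
  where
  lrmaxFrom-≤ : All (_≤ m) σ → lrmaxFrom m σ ≡ 0
  lrmaxFrom-≤ []             = refl
  lrmaxFrom-≤ (y≤m ∷ σ≤m) rewrite <ᵇ-false y≤m = lrmaxFrom-≤ σ≤m

lrmax-max-second : x < N → All (_≤ N) σ → lrmax (x ∷ N ∷ σ) ≡ 2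
lrmax-max-second x<N σ≤N rewrite <ᵇ-true x<N = cong suc (lrmax-max-first σ≤N)

lrmax-∷ʳ-max : All (_< x) σ → lrmax (σ ++ [ x ]) ≡ suc (lrmax σ)
lrmax-∷ʳ-max []           = refl
lrmax-∷ʳ-max {x = x} (y<x ∷ σ<x) = cong suc (lrmaxFrom-∷ʳ-max y<x σ<x)
  where
  lrmaxFrom-∷ʳ-max : m < x → All (_< x) σ → lrmaxFrom m (σ ++ [ x ]) ≡ suc (lrmaxFrom m σ)
  lrmaxFrom-∷ʳ-max m<x [] rewrite <ᵇ-true m<x = refl
  lrmaxFrom-∷ʳ-max {m} {σ = y ∷ _} m<x (y<x ∷ σ<x) with m <ᵇ y
  ... | true  = cong suc (lrmaxFrom-∷ʳ-max y<x σ<x)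
  ... | false = lrmaxFrom-∷ʳ-max m<x σ<x

rlmax-∷-max : All (_< x) σ → rlmax (x ∷ σ) ≡ suc (rlmax σ)
rlmax-∷-max {x} {σ} σ<x = trans (cong lrmax (List.unfold-reverse x σ))
  (lrmax-∷ʳ-max (All-resp-↭ (↭-sym (↭-reverse σ)) σ<x))

lrmax-++-∷∷ : y ≤ z → ∀ xs ws → lrmax (xs ++ z ∷ y ∷ ws) ≡ lrmax (xs ++ z ∷ ws)
lrmax-++-∷∷ y≤z []       _  rewrite <ᵇ-false y≤z = refl
lrmax-++-∷∷ {y} {z} y≤z (x ∷ xs) ws = cong suc (lrmaxFrom-++-∷∷ x xs)
  where
  lrmaxFrom-++-∷∷ : ∀ m xs → lrmaxFrom m (xs ++ z ∷ y ∷ ws) ≡ lrmaxFrom m (xs ++ z ∷ ws)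
  lrmaxFrom-++-∷∷ m [] with m <ᵇ z | <ᵇ-reflects-< m z
  ... | true  | _        rewrite <ᵇ-false y≤z = refl
  ... | false | ofⁿ m≮z rewrite <ᵇ-false (≤-trans y≤z (≮⇒≥ m≮z)) = refl
  lrmaxFrom-++-∷∷ m (x ∷ xs) with m <ᵇ x
  ... | true  = cong suc (lrmaxFrom-++-∷∷ x xs)
  ... | false = lrmaxFrom-++-∷∷ m xs

lrmin-++-∷∷ : z ≤ y → ∀ xs ws → lrmin (xs ++ z ∷ y ∷ ws) ≡ lrmin (xs ++ z ∷ ws)
lrmin-++-∷∷ z≤y []       _  rewrite <ᵇ-false z≤y = refl
lrmin-++-∷∷ {z} {y} z≤y (x ∷ xs) ws = cong suc (lrminFrom-++-∷∷ x xs)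
  where
  lrminFrom-++-∷∷ : ∀ m xs → lrminFrom m (xs ++ z ∷ y ∷ ws) ≡ lrminFrom m (xs ++ z ∷ ws)
  lrminFrom-++-∷∷ m [] with z <ᵇ m | <ᵇ-reflects-< z m
  ... | true  | _        rewrite <ᵇ-false z≤y = refl
  ... | false | ofⁿ z≮m rewrite <ᵇ-false (≤-trans (≮⇒≥ z≮m) z≤y) = refl
  lrminFrom-++-∷∷ m (x ∷ xs) with x <ᵇ m
  ... | true  = cong suc (lrminFrom-++-∷∷ x xs)
  ... | false = lrminFrom-++-∷∷ m xs

reverse-++-++ : ∀ (xs ys ws : List ℕ) → reverse (xs ++ ys ++ ws) ≡ reverse ws ++ reverse ys ++ reverse xs
reverse-++-++ xs ys ws = begin
  reverse (xs ++ ys ++ ws)                   ≡⟨ List.reverse-++ xs (ys ++ ws) ⟩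
  reverse (ys ++ ws) ++ reverse xs           ≡⟨ cong (_++ reverse xs) (List.reverse-++ ys ws) ⟩
  (reverse ws ++ reverse ys) ++ reverse xs   ≡⟨ List.++-assoc (reverse ws) (reverse ys) (reverse xs) ⟩
  reverse ws ++ reverse ys ++ reverse xs     ∎
  where open ≡-Reasoning

delete-under-reverse : ∀ (f : List ℕ → ℕ) → (∀ xs ws → f (xs ++ z ∷ y ∷ ws) ≡ f (xs ++ z ∷ ws)) →
                       ∀ xs → f (reverse (xs ++ y ∷ z ∷ ws)) ≡ f (reverse (xs ++ z ∷ ws))
delete-under-reverse {z} {y} {ws} f delete xs = begin
  f (reverse (xs ++ y ∷ z ∷ ws))       ≡⟨ cong f (reverse-++-++ xs (y ∷ z ∷ []) ws) ⟩
  f (reverse ws ++ z ∷ y ∷ reverse xs) ≡⟨ delete (reverse ws) (reverse xs) ⟩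
  f (reverse ws ++ z ∷ reverse xs)     ≡⟨ cong f (reverse-++-++ xs (z ∷ []) ws) ⟨
  f (reverse (xs ++ z ∷ ws))           ∎
  where open ≡-Reasoning

rlmax-++-∷∷ : y ≤ z → ∀ xs ws → rlmax (xs ++ y ∷ z ∷ ws) ≡ rlmax (xs ++ z ∷ ws)
rlmax-++-∷∷ y≤z xs ws = delete-under-reverse lrmax (lrmax-++-∷∷ y≤z) xs

rlmin-++-∷∷ : z ≤ y → ∀ xs ws → rlmin (xs ++ y ∷ z ∷ ws) ≡ rlmin (xs ++ z ∷ ws)
rlmin-++-∷∷ z≤y xs ws = delete-under-reverse lrmin (lrmin-++-∷∷ z≤y) xs

sum-map-++ : ∀ {A : Set} (f : A → ℤ) xs ys →
             sumℤ (map f (xs ++ ys)) ≡ sumℤ (map f xs) + sumℤ (map f ys)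
sum-map-++ f []       ys = sym (ℤ.+-identityˡ _)
sum-map-++ f (x ∷ xs) ys = trans (cong (_+_ (f x)) (sum-map-++ f xs ys)) (sym (ℤ.+-assoc (f x) _ _))

sum-map-↭ : ∀ {A : Set} (f : A → ℤ) {xs ys} → xs ↭ ys → sumℤ (map f xs) ≡ sumℤ (map f ys)
sum-map-↭ f xs↭ys = foldr-commMonoid ℤ+.setoid ℤ+.isCommutativeMonoid (↭⇒↭ₛ (Perm.map⁺ f xs↭ys))
  where module ℤ+ = CommutativeMonoid ℤ.+-0-commutativeMonoid

sum-map-scale : ∀ {A : Set} c (f g : A → ℤ) xs → (∀ {x} → x ∈ xs → f x ≡ c * g x) →
                sumℤ (map f xs) ≡ c * sumℤ (map g xs)
sum-map-scale c f g []       _    = sym (ℤ.*-zeroʳ c)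
sum-map-scale c f g (x ∷ xs) f≡cg = begin
  f x + sumℤ (map f xs)         ≡⟨ cong₂ _+_ (f≡cg (here refl)) (sum-map-scale c f g xs (f≡cg ∘ there)) ⟩
  c * g x + c * sumℤ (map g xs) ≡⟨ ℤ.*-distribˡ-+ c (g x) _ ⟨
  c * (g x + sumℤ (map g xs))   ∎
  where open ≡-Reasoning

sum-Sn-suc-suc : ∀ (f : List ℕ → ℤ) n → sumℤ (map f (Sn (suc (suc n)))) ≡
  sumℤ (map (f ∘ (suc n ∷_)) (Sn (suc n))) + sumℤ (map (f ∘ insertSecond (suc n)) (Sn (suc n)))
sum-Sn-suc-suc f n = begin
  sumℤ (map f (Sn (suc M)))                                         ≡⟨ sum-map-↭ f (Sn-suc-suc-↭ n) ⟩
  sumℤ (map f (map (M ∷_) (Sn M) ++ map (insertSecond M) (Sn M)))  ≡⟨ sum-map-++ f (map (M ∷_) (Sn M)) _ ⟩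
  sumℤ (map f (map (M ∷_) (Sn M))) + sumℤ (map f (map (insertSecond M) (Sn M)))
    ≡⟨ cong₂ (λ xs ys → sumℤ xs + sumℤ ys) (List.map-∘ (Sn M)) (List.map-∘ (Sn M)) ⟨
  sumℤ (map (f ∘ (M ∷_)) (Sn M)) + sumℤ (map (f ∘ insertSecond M) (Sn M)) ∎
  where
  open ≡-Reasoning
  M : ℕ
  M = suc n

sum-applyUpTo-zero : ∀ (h : ℕ → ℤ) f n → (∀ i → h (f i) ≡ + 0) → sumℤ (map h (applyUpTo f n)) ≡ + 0
sum-applyUpTo-zero h f zero    _      = refl
sum-applyUpTo-zero h f (suc n) h∘f≡0 =
  cong₂ _+_ (h∘f≡0 0) (sum-applyUpTo-zero h (f ∘ suc) n (h∘f≡0 ∘ suc))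

conv-quadratic : ∀ (f g : ℕ → ℤ) → (∀ i → f (3 ℕ.+ i) ≡ + 0) → ∀ n →
                 conv f g (2 ℕ.+ n) ≡ f 0 * g (2 ℕ.+ n) + (f 1 * g (1 ℕ.+ n) + f 2 * g n)
conv-quadratic f g f≡0 n =
  cong (λ z → term 0 + (term 1 + z)) (trans (cong (_+_ (term 2)) tail≡0) (ℤ.+-identityʳ (term 2)))
  where
  term : ℕ → ℤ
  term i = f i * g ((2 ℕ.+ n) ℕ.∸ i)
  tail≡0 : sumℤ (map term (applyUpTo (3 ℕ.+_) n)) ≡ + 0
  tail≡0 = sum-applyUpTo-zero term (3 ℕ.+_) n λ i →
    trans (cong (_* g ((2 ℕ.+ n) ℕ.∸ (3 ℕ.+ i))) (f≡0 i)) (ℤ.*-zeroˡ (g (n ℕ.∸ suc i)))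

-- From the recurrences to the rational function

record Recurrences (p q u v s t : ℤ) (F : ℕ → ℤ) : Set where
  field
    a b       : ℕ → ℤ
    F-zero    : F 0 ≡ + 1
    F-one     : F 1 ≡ u * v * s * t
    F-suc-suc : ∀ k → F (suc (suc k)) ≡ u * a k + u * u * b k
    a-zero    : a 0 ≡ q * v * s * (v * s * t)
    b-zero    : b 0 ≡ p * v * s * t * t
    a-suc     : ∀ k → a (suc k) ≡ q * v * s * (a k + b k)
    b-suc     : ∀ k → b (suc k) ≡ p * a k + q * v * b k

module _ {p q u v s t : ℤ} {F : ℕ → ℤ} (rec : Recurrences p q u v s t F) where
  open Recurrences rec

  den-annihilates : ∀ k → den p q u v s t 0 * F (4 ℕ.+ k) +
    (den p q u v s t 1 * F (3 ℕ.+ k) + den p q u v s t 2 * F (2 ℕ.+ k)) ≡ + 0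
  den-annihilates k rewrite F-suc-suc (2 ℕ.+ k) | F-suc-suc (1 ℕ.+ k) | F-suc-suc k
                          | a-suc (1 ℕ.+ k) | b-suc (1 ℕ.+ k) | a-suc k | b-suc k
    = cayley-hamilton p q u v s (a k) (b k)
    where
    cayley-hamilton : ∀ p q u v s a b →
      + 1 * (u * (q * v * s * (q * v * s * (a + b) + (p * a + q * v * b))) +
             u * u * (p * (q * v * s * (a + b)) + q * v * (p * a + q * v * b))) +
      (- (q * v * (+ 1 + s)) * (u * (q * v * s * (a + b)) + u * u * (p * a + q * v * b)) +
       (q * q * v * v * s - q * v * p * s) * (u * a + u * u * b)) ≡ + 0
    cayley-hamilton = solve-∀

  conv-den≡num : ∀ n → conv (den p q u v s t) F n ≡ num p q u v s t n
  conv-den≡num 0 rewrite F-zero = refl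
  conv-den≡num 1 rewrite F-one | F-zero = coefficient₁ q u v s t
    where
    coefficient₁ : ∀ q u v s t →
      + 1 * (u * v * s * t) + (- (q * v * (+ 1 + s)) * + 1 + + 0) ≡ v * t * u * s - q * v * (+ 1 + s)
    coefficient₁ = solve-∀
  conv-den≡num 2 rewrite F-suc-suc 0 | a-zero | b-zero | F-one | F-zero = coefficient₂ p q u v s t
    where
    coefficient₂ : ∀ p q u v s t →
      + 1 * (u * (q * v * s * (v * s * t)) + u * u * (p * v * s * t * t)) +
      (- (q * v * (+ 1 + s)) * (u * v * s * t) + ((q * q * v * v * s - q * v * p * s) * + 1 + + 0)) ≡
      q * q * v * v * s + v * t * u * s * (p * t * u) - q * v * (s * (p + v * t * u))
    coefficient₂ = solve-∀
  conv-den≡num 3 rewrite F-suc-suc 1 | a-suc 0 | b-suc 0 | F-suc-suc 0 | a-zero | b-zero | F-one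
    = coefficient₃ p q u v s t
    where
    coefficient₃ : ∀ p q u v s t →
      + 1 * (u * (q * v * s * (q * v * s * (v * s * t) + p * v * s * t * t)) +
             u * u * (p * (q * v * s * (v * s * t)) + q * v * (p * v * s * t * t))) +
      (- (q * v * (+ 1 + s)) * (u * (q * v * s * (v * s * t)) + u * u * (p * v * s * t * t)) +
       ((q * q * v * v * s - q * v * p * s) * (u * v * s * t) + (+ 0 * + 1 + + 0))) ≡
      - (q * v * (p * u * s * s * v * t * (- (+ 1) + t) * (- (+ 1) + u)))
    coefficient₃ = solve-∀
  conv-den≡num (suc (suc (suc (suc k)))) =
    trans (conv-quadratic (den p q u v s t) F (λ _ → refl) (2 ℕ.+ k)) (den-annihilates k)

-- The weights satisfy the recurrences

module Weights (p q u v s t : ℤ) where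

  weight : List ℕ → ℤ
  weight σ = p ^ asc σ * q ^ des σ * u ^ lrmax σ * v ^ rlmax σ * s ^ lrmin σ * t ^ rlmin σ

  monomial : ℕ → ℕ → ℕ → ℕ → ℕ → ℤ
  monomial i j k l m = p ^ i * q ^ j * v ^ k * s ^ l * t ^ m

  weight′ : List ℕ → ℤ
  weight′ σ = monomial (asc σ) (des σ) (rlmax σ) (lrmin σ) (rlmin σ)

  monomial-cong : ∀ {i j k l m i′ j′ k′ l′ m′} → i ≡ i′ → j ≡ j′ → k ≡ k′ → l ≡ l′ → m ≡ m′ →
                  monomial i j k l m ≡ monomial i′ j′ k′ l′ m′
  monomial-cong refl refl refl refl refl = refl

  monomial-qvs : ∀ i j k l m → monomial i (suc j) (suc k) (suc l) m ≡ q * v * s * monomial i j k l m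
  monomial-qvs i j k l m = identity q v s (p ^ i) (q ^ j) (v ^ k) (s ^ l) (t ^ m)
    where
    identity : ∀ q v s P Q V S T → P * (q * Q) * (v * V) * (s * S) * T ≡ q * v * s * (P * Q * V * S * T)
    identity = solve-∀

  monomial-p : ∀ i j k l m → monomial (suc i) j k l m ≡ p * monomial i j k l m
  monomial-p i j k l m = identity p (p ^ i) (q ^ j) (v ^ k) (s ^ l) (t ^ m)
    where
    identity : ∀ p P Q V S T → p * P * Q * V * S * T ≡ p * (P * Q * V * S * T)
    identity = solve-∀

  monomial-qv : ∀ i j k l m → monomial i (suc j) (suc k) l m ≡ q * v * monomial i j k l m
  monomial-qv i j k l m = identity q v (p ^ i) (q ^ j) (v ^ k) (s ^ l) (t ^ m)
    where
    identity : ∀ q v P Q V S T → P * (q * Q) * (v * V) * S * T ≡ q * v * (P * Q * V * S * T)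
    identity = solve-∀

  weight≡u^lrmax*weight′ : ∀ σ → weight σ ≡ u ^ lrmax σ * weight′ σ
  weight≡u^lrmax*weight′ σ =
    identity (p ^ asc σ) (q ^ des σ) (u ^ lrmax σ) (v ^ rlmax σ) (s ^ lrmin σ) (t ^ rlmin σ)
    where
    identity : ∀ P Q U V S T → P * Q * U * V * S * T ≡ U * (P * Q * V * S * T)
    identity = solve-∀

  weight-max-first : All (_≤ N) σ → weight (N ∷ σ) ≡ u * weight′ (N ∷ σ)
  weight-max-first {N} {σ} σ≤N = begin
    weight (N ∷ σ)            ≡⟨ weight≡u^lrmax*weight′ (N ∷ σ) ⟩
    u ^ lrmax (N ∷ σ) * W     ≡⟨ cong (λ k → u ^ k * W) (lrmax-max-first σ≤N) ⟩
    u ^ 1 * W                 ≡⟨ cong (_* W) (ℤ.^-identityʳ u) ⟩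
    u * W                     ∎
    where
    open ≡-Reasoning
    W : ℤ
    W = weight′ (N ∷ σ)

  weight-max-second : x < N → All (_≤ N) σ → weight (x ∷ N ∷ σ) ≡ u * u * weight′ (x ∷ N ∷ σ)
  weight-max-second {x} {N} {σ} x<N σ≤N = begin
    weight (x ∷ N ∷ σ)            ≡⟨ weight≡u^lrmax*weight′ (x ∷ N ∷ σ) ⟩
    u ^ lrmax (x ∷ N ∷ σ) * W     ≡⟨ cong (λ k → u ^ k * W) (lrmax-max-second x<N σ≤N) ⟩
    u * u ^ 1 * W                 ≡⟨ cong (λ w → u * w * W) (ℤ.^-identityʳ u) ⟩
    u * u * W                     ∎
    where
    open ≡-Reasoning
    W : ℤ
    W = weight′ (x ∷ N ∷ σ)

  weight′-max-first : All (_< N) (y ∷ ρ) → weight′ (N ∷ y ∷ ρ) ≡ q * v * s * weight′ (y ∷ ρ)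
  weight′-max-first {N} {y} {ρ} yρ<N@(y<N ∷ _) =
    trans (monomial-cong (asc-descent ρ y<N) (des-descent ρ y<N) (rlmax-∷-max yρ<N) (lrmin-descent ρ y<N)
                         (rlmin-++-∷∷ (<⇒≤ y<N) [] ρ))
          (monomial-qvs (asc (y ∷ ρ)) (des (y ∷ ρ)) (rlmax (y ∷ ρ)) (lrmin (y ∷ ρ)) (rlmin (y ∷ ρ)))

  weight′-max-second-descent : x < N → All (_< x) (y ∷ ρ) →
                               weight′ (x ∷ N ∷ y ∷ ρ) ≡ p * weight′ (x ∷ y ∷ ρ)
  weight′-max-second-descent {x} {N} {y} {ρ} x<N yρ<x@(y<x ∷ _) =
    trans (monomial-cong asc≡ des≡ rlmax≡ (lrmin-ascent (y ∷ ρ) (<⇒≤ x<N))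
                         (rlmin-++-∷∷ (<⇒≤ y<N) (x ∷ []) ρ))
          (monomial-p (asc xyρ) (des xyρ) (rlmax xyρ) (lrmin xyρ) (rlmin xyρ))
    where
    xyρ : List ℕ
    xyρ = x ∷ y ∷ ρ
    y<N : y < N
    y<N = ℕ.<-trans y<x x<N
    asc≡ : asc (x ∷ N ∷ y ∷ ρ) ≡ suc (asc (x ∷ y ∷ ρ))
    asc≡ = trans (asc-ascent (y ∷ ρ) x<N) (cong suc (trans (asc-descent ρ y<N) (sym (asc-descent ρ y<x))))
    des≡ : des (x ∷ N ∷ y ∷ ρ) ≡ des (x ∷ y ∷ ρ)
    des≡ = trans (des-ascent (y ∷ ρ) x<N) (trans (des-descent ρ y<N) (sym (des-descent ρ y<x)))
    rlmax≡ : rlmax (x ∷ N ∷ y ∷ ρ) ≡ rlmax (x ∷ y ∷ ρ)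
    rlmax≡ = trans (rlmax-++-∷∷ (<⇒≤ x<N) [] (y ∷ ρ))
                   (trans (rlmax-∷-max (All.map (λ z<x → ℕ.<-trans z<x x<N) yρ<x)) (sym (rlmax-∷-max yρ<x)))

  weight′-max-second-ascent : x < y → All (_< N) (y ∷ ρ) →
                              weight′ (x ∷ N ∷ y ∷ ρ) ≡ q * v * weight′ (x ∷ y ∷ ρ)
  weight′-max-second-ascent {x} {y} {N} {ρ} x<y yρ<N@(y<N ∷ _) =
    trans (monomial-cong asc≡ des≡ rlmax≡ (lrmin-ascent (y ∷ ρ) (<⇒≤ x<N))
                         (rlmin-++-∷∷ (<⇒≤ y<N) (x ∷ []) ρ))
          (monomial-qv (asc xyρ) (des xyρ) (rlmax xyρ) (lrmin xyρ) (rlmin xyρ))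
    where
    xyρ : List ℕ
    xyρ = x ∷ y ∷ ρ
    x<N : x < N
    x<N = ℕ.<-trans x<y y<N
    asc≡ : asc (x ∷ N ∷ y ∷ ρ) ≡ asc (x ∷ y ∷ ρ)
    asc≡ = trans (asc-ascent (y ∷ ρ) x<N) (trans (cong suc (asc-descent ρ y<N)) (sym (asc-ascent ρ x<y)))
    des≡ : des (x ∷ N ∷ y ∷ ρ) ≡ suc (des (x ∷ y ∷ ρ))
    des≡ = trans (des-ascent (y ∷ ρ) x<N) (trans (des-descent ρ y<N) (cong suc (sym (des-ascent ρ x<y))))
    rlmax≡ : rlmax (x ∷ N ∷ y ∷ ρ) ≡ suc (rlmax (x ∷ y ∷ ρ))
    rlmax≡ = trans (rlmax-++-∷∷ (<⇒≤ x<N) [] (y ∷ ρ))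
                   (trans (rlmax-∷-max yρ<N) (cong suc (sym (rlmax-++-∷∷ (<⇒≤ x<y) [] ρ))))

  a b : ℕ → ℤ
  a k = sumℤ (map (weight′ ∘ (suc k ∷_)) (Sn (suc k)))
  b k = sumℤ (map (weight′ ∘ insertSecond (suc k)) (Sn (suc k)))

  F-suc-suc : ∀ k → F3coeff p q u v s t (suc (suc k)) ≡ u * a k + u * u * b k
  F-suc-suc k = trans (sum-Sn-suc-suc weight k)
    (cong₂ _+_ (sum-map-scale u _ _ (Sn (suc k)) max-first)
               (sum-map-scale (u * u) _ _ (Sn (suc k)) max-second))
    where
    max-first : τ ∈ Sn (suc k) → weight (suc k ∷ τ) ≡ u * weight′ (suc k ∷ τ)
    max-first τ∈ = weight-max-first (All.map <⇒≤ (Sn-bounded (suc k) τ∈))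
    max-second : τ ∈ Sn (suc k) →
                 weight (insertSecond (suc k) τ) ≡ u * u * weight′ (insertSecond (suc k) τ)
    max-second {[]}    τ∈ = ⊥-elim ([]∉Sn-suc k τ∈)
    max-second {_ ∷ _} τ∈ with Sn-bounded (suc k) τ∈
    ... | x<N ∷ ρ<N = weight-max-second x<N (All.map <⇒≤ ρ<N)

  a-suc : ∀ k → a (suc k) ≡ q * v * s * (a k + b k)
  a-suc k = trans (sum-map-scale (q * v * s) _ weight′ (Sn (suc (suc k))) max-first)
                  (cong (q * v * s *_) (sum-Sn-suc-suc weight′ k))
    where
    max-first : τ ∈ Sn (suc (suc k)) → weight′ (suc (suc k) ∷ τ) ≡ q * v * s * weight′ τ
    max-first {[]}    τ∈ = ⊥-elim ([]∉Sn-suc (suc k) τ∈)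
    max-first {_ ∷ _} τ∈ = weight′-max-first (Sn-bounded (suc (suc k)) τ∈)

  b-suc : ∀ k → b (suc k) ≡ p * a k + q * v * b k
  b-suc k = trans (sum-Sn-suc-suc (weight′ ∘ insertSecond (suc (suc k))) k)
    (cong₂ _+_ (sum-map-scale p _ _ (Sn (suc k)) descent)
               (sum-map-scale (q * v) _ _ (Sn (suc k)) ascent))
    where
    descent : τ ∈ Sn (suc k) → weight′ (suc k ∷ suc (suc k) ∷ τ) ≡ p * weight′ (suc k ∷ τ)
    descent {[]}    τ∈ = ⊥-elim ([]∉Sn-suc k τ∈)
    descent {_ ∷ _} τ∈ = weight′-max-second-descent (n<1+n (suc k)) (Sn-bounded (suc k) τ∈)
    ascent : τ ∈ Sn (suc k) → weight′ (insertSecond (suc (suc k)) (insertSecond (suc k) τ)) ≡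
                               q * v * weight′ (insertSecond (suc k) τ)
    ascent {[]}    τ∈ = ⊥-elim ([]∉Sn-suc k τ∈)
    ascent {_ ∷ _} τ∈ with Sn-bounded (suc k) τ∈
    ... | x<N ∷ ρ<N = weight′-max-second-ascent x<N (All<-∷-max ρ<N)

  -- The ring solver has no _^_, so the powers in the initial values are written out.
  F3coeff-recurrences : Recurrences p q u v s t (F3coeff p q u v s t)
  F3coeff-recurrences = record
    { a = a ; b = b
    ; F-zero = refl
    ; F-one = value-F₁ p q u v s t
    ; F-suc-suc = F-suc-suc
    ; a-zero = value-a₀ p q u v s t
    ; b-zero = value-b₀ p q u v s t
    ; a-suc = a-suc
    ; b-suc = b-suc
    }
    where
    value-F₁ : ∀ p q u v s t →
      + 1 * + 1 * (u * + 1) * (v * + 1) * (s * + 1) * (t * + 1) + + 0 ≡ u * v * s * t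
    value-F₁ = solve-∀
    value-a₀ : ∀ p q u v s t →
      + 1 * (q * + 1) * (v * (v * + 1)) * (s * (s * + 1)) * (t * + 1) + + 0 ≡ q * v * s * (v * s * t)
    value-a₀ = solve-∀
    value-b₀ : ∀ p q u v s t →
      p * + 1 * + 1 * (v * + 1) * (s * + 1) * (t * (t * + 1)) + + 0 ≡ p * v * s * t * t
    value-b₀ = solve-∀

theorem2p1 : (p q u v s t : ℤ) (n : ℕ) →
    conv (den p q u v s t) (F3coeff p q u v s t) n ≡ num p q u v s t n
theorem2p1 p q u v s t = conv-den≡num (Weights.F3coeff-recurrences p q u v s t)
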